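{- Let $G=(V,E)$ be a graph and $S\subseteq V$ with $|S|=k$ such that every connected component of $G-S$ is a clique or a tree. Let $P$ be a cycle of $G$ that intersects $S$, let $P_1,\dots,P_l$ be its fragments in the order they appear along $P$, and for each $i\in\{1,\dots,l\}$ let $v_i\in S$ be such that $P_i$ is a $v_i$–$v_{i+1}$ path (indices modulo $l$). Then there is a cycle $P'$ in $G$ that decomposes into $l$ fragments $P'_1,\dots,P'_l$ such that for every $i$: $P'_i$ is a $v_i$–$v_{i+1}$ path; the internal vertices of $P'_i$ (if any) belong to a component labeled $(v_i,v_{i+1})$; and $|P|\le|P'|$.
   Context: Let $\mathcal{C}_{\mathrm{clique}}$ and $\mathcal{C}_{\mathrm{tree}}$ be the components of $G-S$ that are cliques and trees respectively (components that are both may be placed in either). A fragment of a cycle $P$ is a subpath of $P$ whose two endpoints lie in $S$ and which contains no other vertex of $S$; length of a path or cycle is its number of edges. For $u,v\in S$ (possibly equal) and a component $C$, define $q(C,u,v)$: (i) $-\infty$ if $N(u)\cap C=\emptyset$ or $N(v)\cap C=\emptyset$; (ii) if $C\in\mathcal{C}_{\mathrm{clique}}$ and $N(u)\cap C=N(v)\cap C=\{w\}$ for a single vertex $w$, then $2$; (iii) if $C\in\mathcal{C}_{\mathrm{clique}}$ and (i),(ii) fail, then $|C|+1$; (iv) if $C\in\mathcal{C}_{\mathrm{tree}}$ and (i) fails, then $2$ plus the maximum, over $w_u\in N(u)\cap C$ and $w_v\in N(v)\cap C$, of the length of the $w_u$–$w_v$ path in the tree $C$. For each pair $(u,v)$ of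 (possibly equal) vertices of $S$, the (at most) $k$ components $C$ with the largest positive values $q(C,u,v)$ (ties broken arbitrarily; all such components if fewer than $k$ have positive value) receive the label $(u,v)$. -}

module Defs where

open import Data.Nat using (ℕ; zero; suc; _+_; _∸_; _≤_; _<_; _%_)
open import Data.Nat.DivMod using (m%n<n)
open import Data.Fin using (Fin; toℕ; fromℕ<)
open import Data.Fin.Subset using (Subset; _∈_; _∉_; ∣_∣)
open import Data.Bool using (Bool; true; false)
open import Data.Maybe using (Maybe; just; nothing)
open import Data.List using (List; []; _∷_; _++_; [_]; length; head; last; concat)
import Data.List as List
open import Data.List.Relation.Unary.All using (All)
open import Data.List.Relation.Unary.Unique.Propositional using (Unique)
open import Data.Product using (Σ; ∃; ∃-syntax; _×_; _,_)
open import Data.Sum using (_⊎_)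
open import Data.Unit using (⊤)
open import Data.Empty using (⊥)
import Data.Vec as Vec
open import Relation.Nullary using (¬_; does)
open import Relation.Binary.PropositionalEquality using (_≡_; _≢_)
import Data.Fin as Fin

record Graph (n : ℕ) : Set where
  field
    adj     : Fin n → Fin n → Bool
    adj-sym : ∀ x y → adj x y ≡ adj y x
    adj-irr : ∀ x → adj x x ≡ false

module _ {n : ℕ} (G : Graph n) where
  open Graph G

  E : Fin n → Fin n → Set
  E x y = adj x y ≡ true

  Chain : List (Fin n) → Set
  Chain []           = ⊤
  Chain (x ∷ [])     = ⊤
  Chain (x ∷ y ∷ xs) = E x y × Chain (y ∷ xs)

  -- ps is (the vertex sequence of) an a–b path; its length is length ps ∸ 1
  IsPath : Fin n → Fin n → List (Fin n) → Set
  IsPath a b ps = head ps ≡ just a × last ps ≡ just b × Chain ps × Unique ps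

  -- cs is (the vertex sequence of) a cycle; its length is length cs
  IsCycle : List (Fin n) → Set
  IsCycle []       = ⊥
  IsCycle (x ∷ xs) = 3 ≤ length (x ∷ xs) × Unique (x ∷ xs) × Chain (x ∷ xs ++ [ x ])

  data Reach (S : Subset n) : Fin n → Fin n → Set where
    here : ∀ {x} → x ∉ S → Reach S x x
    step : ∀ {x y z} → x ∉ S → E x y → Reach S y z → Reach S x z

  -- An explicit enumeration of the connected components of G - S by Fin m.
  -- comp x = just c  iff  x ∉ S and x lies in component c.
  record Components (S : Subset n) (m : ℕ) : Set where
    field
      comp      : Fin n → Maybe (Fin m)
      comp-S    : ∀ x → x ∈ S → comp x ≡ nothing
      comp-notS : ∀ x → x ∉ S → ∃[ c ] comp x ≡ just c
      comp-conn : ∀ x y c → comp x ≡ just c → comp y ≡ just c → Reach S x y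
      comp-sep  : ∀ x y c → comp x ≡ just c → Reach S x y → comp y ≡ just c
      comp-surj : ∀ c → ∃[ x ] comp x ≡ just c

  module _ {S : Subset n} {m : ℕ} (Cs : Components S m) where
    open Components Cs

    InC : Fin m → Fin n → Set
    InC c x = comp x ≡ just c

    inC? : Fin m → Fin n → Bool
    inC? c x with comp x
    ... | nothing = false
    ... | just d  = does (c Fin.≟ d)

    csize : Fin m → ℕ
    csize c = ∣ Vec.tabulate (inC? c) ∣

    IsClique : Fin m → Set
    IsClique c = ∀ x y → InC c x → InC c y → x ≢ y → E x y

    -- a tree: connected (guaranteed by Components) and acyclic
    IsTree : Fin m → Set
    IsTree c = ¬ (Σ (List (Fin n)) λ cs → IsCycle cs × All (InC c) cs)

    -- cls c = true : c is placed in C_clique ; cls c = false : c is placed in C_tree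
    ValidClassification : (Fin m → Bool) → Set
    ValidClassification cls = ∀ c → (cls c ≡ true → IsClique c) × (cls c ≡ false → IsTree c)

    HasNbr : Fin n → Fin m → Set
    HasNbr u c = ∃[ w ] InC c w × E u w

    SingleCommon : Fin n → Fin n → Fin m → Fin n → Set
    SingleCommon u v c w =
      InC c w × E u w × E v w
      × (∀ w′ → InC c w′ → E u w′ → w′ ≡ w)
      × (∀ w′ → InC c w′ → E v w′ → w′ ≡ w)

    TreeDist : Fin m → Fin n → Fin n → ℕ → Set
    TreeDist c w₁ w₂ d = Σ (List (Fin n)) λ ps → IsPath w₁ w₂ ps × All (InC c) ps × length ps ∸ 1 ≡ d

    IsMaxDist : Fin m → Fin n → Fin n → ℕ → Set
    IsMaxDist c u v r =
      (∃[ wu ] ∃[ wv ] InC c wu × E u wu × InC c wv × E v wv × TreeDist c wu wv r)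
      × (∀ wu wv d → InC c wu → E u wu → InC c wv → E v wv → TreeDist c wu wv d → d ≤ r)

    -- Q cls c u v r : q(C,u,v) = r (a finite value); q(C,u,v) = -∞ iff no such r exists
    data Q (cls : Fin m → Bool) (c : Fin m) (u v : Fin n) : ℕ → Set where
      q-single : ∀ w → cls c ≡ true → SingleCommon u v c w → Q cls c u v 2
      q-clique : cls c ≡ true → HasNbr u c → HasNbr v c →
                 ¬ (∃[ w ] SingleCommon u v c w) → Q cls c u v (suc (csize c))
      q-tree   : ∀ r → cls c ≡ false → HasNbr u c → HasNbr v c →
                 IsMaxDist c u v r → Q cls c u v (2 + r)

    -- L u v is the set of components receiving label (u,v): for u,v ∈ S it consists of
    -- (at most) k components with the largest positive q-values (ties arbitrary).
    ValidLabelling : (Fin m → Bool) → ℕ → (Fin n → Fin n → Subset m) → Set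
    ValidLabelling cls k L = ∀ u v → u ∈ S → v ∈ S →
      (∀ c → c ∈ L u v → ∃[ r ] Q cls c u v r)
      × ∣ L u v ∣ ≤ k
      × (∣ L u v ∣ ≡ k ⊎ (∀ c r → Q cls c u v r → c ∈ L u v))
      × (∀ c c′ r r′ → c ∈ L u v → c′ ∉ L u v → Q cls c u v r → Q cls c′ u v r′ → r′ ≤ r)

next : ∀ {l} → Fin (suc l) → Fin (suc l)
next {l} i = fromℕ< (m%n<n (suc (toℕ i)) (suc l))

-- vertex sequence v₀ W₀ v₁ W₁ … v_l W_l of a cycle whose i-th fragment is v_i W_i v_{i+1}
fragSeq : ∀ {n l} → (Fin (suc l) → Fin n) → (Fin (suc l) → List (Fin n)) → List (Fin n)
fragSeq v W = concat (List.tabulate (λ i → v i ∷ W i))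

{-# OPTIONS --safe #-}
-- Fragments are rerouted one at a time, never shortening the cycle. For u, w ∈ S, q(C, u, w) is the
-- largest length of a u–w path with all inner vertices in C: a Hamiltonian path of the clique C (or the
-- path through the single common neighbour), respectively a longest tree path between neighbours of u
-- and w. So a fragment P_i with interior in C has |P_i| ≤ q(C, v_i, v_{i+1}). If C is not labelled
-- (v_i, v_{i+1}), that label is full: it names |S| components, none of them C. The cycle meets at most
-- l ≤ |S| components (one per fragment, and the v_i are distinct vertices of S), C among them, so some
-- labelled C′ avoids the cycle, and q(C′) ≥ q(C) by the choice of labels. Replacing P_i by a longest
-- v_i–v_{i+1} path through C′ keeps a cycle, since C′ is disjoint from the other fragments.
module Submission where

open import Defs
open import Data.Nat using (ℕ; zero; suc; _+_; _≤_; _<_; _∸_; _%_; z≤n; s≤s)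
open import Data.Nat.Properties
  using (≤-trans; ≤-refl; ≤-pred; ≤∧≢⇒<; <⇒≢; n≤1+n; +-monoˡ-≤; module ≤-Reasoning)
import Data.Nat.DivMod as ℕ
open import Data.Fin using (Fin; zero; suc; toℕ)
import Data.Fin as Fin
import Data.Fin.Properties as Fin
open import Data.Fin.Subset using (Subset; inside; outside; _∈_; _∉_; ∣_∣)
open import Data.Fin.Subset.Properties using (_∈?_)
open import Data.Bool using (Bool; true; false)
import Data.Bool as Bool
open import Data.Maybe using (Maybe; just; nothing)
import Data.Maybe.Properties as Maybe
open import Data.Maybe.Relation.Unary.Any using (just)
open import Data.Vec.Base using ([]; _∷_; here; there)
import Data.Vec as Vec
import Data.Vec.Properties as Vec
open import Data.Vec.Functional using (updateAt)
open import Data.Vec.Functional.Properties using (updateAt-updates; updateAt-minimal)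
open import Data.List
  using (List; []; _∷_; _++_; [_]; length; map; head; last; concat; tabulate; filter; catMaybes; allFin)
open import Data.List.Properties
  using (length-map; length-++; length-tabulate; length-catMaybes; Any-catMaybes⁺; ++-assoc; tabulate-cong)
open import Data.List.Membership.Propositional using () renaming (_∈_ to _∈ₗ_; _∉_ to _∉ₗ_)
open import Data.List.Membership.Propositional.Properties
  using ( ∈-++⁻; ∈-++⁺ˡ; ∈-++⁺ʳ; ∈-map⁺; ∈-map⁻; ∈-filter⁺; ∈-filter⁻; ∈-allFin
        ; ∈-concat⁺′; ∈-concat⁻′; ∈-tabulate⁺; ∈-tabulate⁻)
import Data.List.Membership.DecPropositional as DecMembership
open import Data.List.Relation.Unary.Any using (here; there)
import Data.List.Relation.Unary.Any as Any
open import Data.List.Relation.Unary.All using (All; []; _∷_; all?)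
import Data.List.Relation.Unary.All as All
import Data.List.Relation.Unary.All.Properties as All
open import Data.List.Relation.Unary.AllPairs using ([]; _∷_)
import Data.List.Relation.Unary.AllPairs as AllPairs
open import Data.List.Relation.Unary.Unique.Propositional using (Unique)
import Data.List.Relation.Unary.Unique.Propositional.Properties as Unique
import Data.List.Relation.Unary.Unique.DecPropositional as UniqueDec
open import Data.List.Relation.Binary.Subset.Propositional using (_⊆_)
open import Data.List.Relation.Binary.Disjoint.Propositional using (Disjoint)
open import Data.Product using (∃; ∃-syntax; _×_; _,_; proj₁; proj₂)
open import Data.Sum using (_⊎_; inj₁; inj₂)
open import Data.Unit using (tt)
open import Function using (_∘_; _∘′_; id; const; case_of_)
open import Relation.Nullary using (Dec; yes; no; ¬_; ¬?; contradiction)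
open import Relation.Nullary.Decidable using (_×-dec_; _→-dec_; dec-true)
open import Relation.Unary using (Pred; Decidable)
open import Relation.Binary.PropositionalEquality
  using (_≡_; _≢_; refl; sym; trans; cong; cong₂; subst; subst₂; module ≡-Reasoning)

-- Lists, finite subsets and bounded search

module _ {a} {A : Set a} where

  ∈-remove : ∀ {x : A} {ys} → x ∈ₗ ys →
             ∃[ zs ] length ys ≡ suc (length zs) × (∀ {y} → y ∈ₗ ys → y ≢ x → y ∈ₗ zs)
  ∈-remove {ys = y ∷ ys} (here refl) = ys , refl , λ { (here refl) y≢x → contradiction refl y≢x
                                                    ; (there p)   _   → p }
  ∈-remove {ys = y ∷ ys} (there x∈ys) with zs , eq , keep ← ∈-remove x∈ys =
    y ∷ zs , cong suc eq , λ { (here refl) _ → here refl ; (there p) y≢x → there (keep p y≢x) }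

  Unique-⊆⇒length≤ : ∀ {xs ys : List A} → Unique xs → xs ⊆ ys → length xs ≤ length ys
  Unique-⊆⇒length≤ {[]}     _            _     = z≤n
  Unique-⊆⇒length≤ {x ∷ xs} (x∉xs ∷ xs!) xs⊆ys with zs , eq , keep ← ∈-remove (xs⊆ys (here refl)) =
    subst (suc (length xs) ≤_) (sym eq)
      (s≤s (Unique-⊆⇒length≤ xs! λ p → keep (xs⊆ys (there p)) λ { refl → All.lookup x∉xs p refl }))

  Unique-++⁻ : ∀ xs {ys : List A} → Unique (xs ++ ys) → Unique xs × Unique ys × Disjoint xs ys
  Unique-++⁻ []       ys! = [] , ys! , λ { (() , _) }
  Unique-++⁻ (x ∷ xs) (x∉ ∷ xs++ys!) with xs! , ys! , disj ← Unique-++⁻ xs xs++ys! =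
    All.++⁻ˡ xs x∉ ∷ xs! , ys! ,
    λ { (here refl , q) → All.lookup (All.++⁻ʳ xs x∉) q refl ; (there p , q) → disj (p , q) }

  Unique-replace : ∀ xs ys {zs ys′ : List A} → Unique (xs ++ ys ++ zs) → Unique ys′ →
                   (∀ {y} → y ∈ₗ ys′ → y ∉ₗ xs ++ ys ++ zs) → Unique (xs ++ ys′ ++ zs)
  Unique-replace xs ys {zs} {ys′} u ys′! fresh
    with xs! , ys++zs! , xs#ys++zs ← Unique-++⁻ xs u
    with _ , zs! , _ ← Unique-++⁻ ys ys++zs! =
    Unique.++⁺ xs! (Unique.++⁺ ys′! zs! ys′#zs) xs#ys′++zs
    where
    ys′#zs : Disjoint ys′ zs
    ys′#zs (p , q) = fresh p (∈-++⁺ʳ xs (∈-++⁺ʳ ys q))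
    xs#ys′++zs : Disjoint xs (ys′ ++ zs)
    xs#ys′++zs (p , q) with ∈-++⁻ ys′ q
    ... | inj₁ r = fresh r (∈-++⁺ˡ p)
    ... | inj₂ r = xs#ys++zs (p , ∈-++⁺ʳ ys r)

  last-∈ : ∀ {xs : List A} {z} → last xs ≡ just z → z ∈ₗ xs
  last-∈ {x ∷ []}     refl = here refl
  last-∈ {x ∷ y ∷ xs} eq   = there (last-∈ {y ∷ xs} eq)

  last-∷ʳ : ∀ (xs : List A) {z} → last (xs ++ [ z ]) ≡ just z
  last-∷ʳ []           = refl
  last-∷ʳ (x ∷ [])     = refl
  last-∷ʳ (x ∷ y ∷ xs) = last-∷ʳ (y ∷ xs)

  head≡last⇒length≤1 : ∀ {xs : List A} {z} → Unique xs → head xs ≡ just z → last xs ≡ just z →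
                       length xs ≤ 1
  head≡last⇒length≤1 {x ∷ []}     _        _    _  = s≤s z≤n
  head≡last⇒length≤1 {x ∷ y ∷ xs} (x∉ ∷ _) refl eq =
    contradiction refl (All.lookup x∉ (last-∈ {y ∷ xs} eq))

  ∈-catMaybes⁺ : ∀ {x : A} {xs} → just x ∈ₗ xs → x ∈ₗ catMaybes xs
  ∈-catMaybes⁺ p = Any-catMaybes⁺ (Any.map (λ { refl → just refl }) p)

  length-replace-≤ : ∀ (xs : List A) {ys ys′} zs → length ys ≤ length ys′ →
                     length (xs ++ ys ++ zs) ≤ length (xs ++ ys′ ++ zs)
  length-replace-≤ []       {ys} {ys′} zs ys≤ys′ rewrite length-++ ys {zs} | length-++ ys′ {zs} =
    +-monoˡ-≤ (length zs) ys≤ys′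
  length-replace-≤ (x ∷ xs) zs ys≤ys′ = s≤s (length-replace-≤ xs zs ys≤ys′)

members : ∀ {m} → Subset m → List (Fin m)
members []            = []
members (inside ∷ p)  = zero ∷ map suc (members p)
members (outside ∷ p) = map suc (members p)

length-members : ∀ {m} (p : Subset m) → length (members p) ≡ ∣ p ∣
length-members []            = refl
length-members (inside ∷ p)  = cong suc (trans (length-map suc (members p)) (length-members p))
length-members (outside ∷ p) = trans (length-map suc (members p)) (length-members p)

∈-members⁺ : ∀ {m} {x : Fin m} (p : Subset m) → x ∈ p → x ∈ₗ members p
∈-members⁺ (inside ∷ p)  here        = here refl
∈-members⁺ (inside ∷ p)  (there x∈p) = there (∈-map⁺ suc (∈-members⁺ p x∈p))
∈-members⁺ (outside ∷ p) (there x∈p) = ∈-map⁺ suc (∈-members⁺ p x∈p)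

∈-members⁻ : ∀ {m} {x : Fin m} (p : Subset m) → x ∈ₗ members p → x ∈ p
∈-members⁻ (inside ∷ p)  (here refl) = here
∈-members⁻ (inside ∷ p)  (there q) with _ , x∈ , refl ← ∈-map⁻ suc q = there (∈-members⁻ p x∈)
∈-members⁻ (outside ∷ p) q         with _ , x∈ , refl ← ∈-map⁻ suc q = there (∈-members⁻ p x∈)

members-Unique : ∀ {m} (p : Subset m) → Unique (members p)
members-Unique []            = []
members-Unique (inside ∷ p)  =
  All.¬Any⇒All¬ _ (λ q → case ∈-map⁻ suc q of λ { (_ , _ , ()) })
  ∷ Unique.map⁺ Fin.suc-injective (members-Unique p)
members-Unique (outside ∷ p) = Unique.map⁺ Fin.suc-injective (members-Unique p)

module _ {m : ℕ} (p : Subset m) where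
  open DecMembership (Fin._≟_ {m}) using () renaming (_∈?_ to _∈ₗ?_)

  length≤∣p∣ : ∀ {xs} → Unique xs → (∀ {x} → x ∈ₗ xs → x ∈ p) → length xs ≤ ∣ p ∣
  length≤∣p∣ xs! xs⊆p = subst (_ ≤_) (length-members p) (Unique-⊆⇒length≤ xs! (∈-members⁺ p ∘ xs⊆p))

  ∣p∣≤length : ∀ {ys} → (∀ {x} → x ∈ p → x ∈ₗ ys) → ∣ p ∣ ≤ length ys
  ∣p∣≤length p⊆ys =
    subst (_≤ _) (length-members p) (Unique-⊆⇒length≤ (members-Unique p) (p⊆ys ∘ ∈-members⁻ p))

  ∃-missing-member : ∀ {ys c} → length ys ≤ ∣ p ∣ → c ∈ₗ ys → c ∉ p → ∃[ c′ ] c′ ∈ p × c′ ∉ₗ ys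
  ∃-missing-member {ys} {c} ys≤p c∈ys c∉p
    with Fin.any? (λ c′ → c′ ∈? p ×-dec ¬? (c′ ∈ₗ? ys))
  ... | yes found = found
  ... | no none   = contradiction (≤-trans c∷p≤ys ys≤p) λ p<p → <⇒≢ p<p refl
    where
    p⊆ys : ∀ {x} → x ∈ p → x ∈ₗ ys
    p⊆ys {x} x∈p with x ∈ₗ? ys
    ... | yes x∈ys = x∈ys
    ... | no  x∉ys = contradiction (x , x∈p , x∉ys) none
    c∷p≤ys : suc ∣ p ∣ ≤ length ys
    c∷p≤ys = subst (λ k → suc k ≤ length ys) (length-members p)
      (Unique-⊆⇒length≤ (All.¬Any⇒All¬ _ (c∉p ∘ ∈-members⁻ p) ∷ members-Unique p)
                     λ { (here refl) → c∈ys ; (there q) → p⊆ys (∈-members⁻ p q) })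

module _ {p} {P : Pred ℕ p} (P? : Decidable P) where

  bounded-maximum : ∀ B → (∀ {d} → P d → d ≤ B) → ∀ {d₀} → P d₀ → ∃[ r ] P r × (∀ {d} → P d → d ≤ r)
  bounded-maximum B bound p₀ with P? B
  ... | yes pB = B , pB , bound
  bounded-maximum zero    bound p₀ | no ¬pB with z≤n ← bound p₀ = contradiction p₀ ¬pB
  bounded-maximum (suc B) bound p₀ | no ¬pB = bounded-maximum B bound′ p₀
    where
    bound′ : ∀ {d} → P d → d ≤ B
    bound′ {d} pd = ≤-pred (≤∧≢⇒< (bound pd) λ { refl → ¬pB pd })

∃-list-of-length? : ∀ {n p} k {P : Pred (List (Fin n)) p} → Decidable P → Dec (∃[ xs ] length xs ≡ k × P xs)
∃-list-of-length? zero    P? with P? []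
... | yes p = yes ([] , refl , p)
... | no ¬p = no λ { ([] , _ , p) → ¬p p }
∃-list-of-length? (suc k) P? with Fin.any? (λ x → ∃-list-of-length? k (P? ∘ (x ∷_)))
... | yes (x , xs , refl , p) = yes (x ∷ xs , refl , p)
... | no none = no λ { (x ∷ xs , refl , p) → none (x , xs , refl , p) }

-- Walks in G and the components of G − S

module _ {n : ℕ} (G : Graph n) where
  open Graph G

  E-sym : ∀ {x y} → E G x y → E G y x
  E-sym {x} {y} e = trans (adj-sym y x) e

  E? : ∀ x y → Dec (E G x y)
  E? x y = adj x y Bool.≟ true

  Chain? : Decidable (Chain G)
  Chain? []           = yes tt
  Chain? (x ∷ [])     = yes tt
  Chain? (x ∷ y ∷ xs) = E? x y ×-dec Chain? (y ∷ xs)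

  IsPath? : ∀ a b → Decidable (IsPath G a b)
  IsPath? a b ps = Maybe.≡-dec Fin._≟_ (head ps) (just a) ×-dec Maybe.≡-dec Fin._≟_ (last ps) (just b)
                   ×-dec Chain? ps ×-dec UniqueDec.unique? Fin._≟_ ps

  Chain-++⁻ : ∀ xs {y ys} → Chain G (xs ++ y ∷ ys) → Chain G (xs ++ [ y ]) × Chain G (y ∷ ys)
  Chain-++⁻ []            ch       = tt , ch
  Chain-++⁻ (x ∷ [])      (e , ch) = (e , tt) , ch
  Chain-++⁻ (x ∷ x′ ∷ xs) (e , ch) with ch₁ , ch₂ ← Chain-++⁻ (x′ ∷ xs) ch = (e , ch₁) , ch₂

  Chain-++⁺ : ∀ xs {y ys} → Chain G (xs ++ [ y ]) → Chain G (y ∷ ys) → Chain G (xs ++ y ∷ ys)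
  Chain-++⁺ []            _         ch = ch
  Chain-++⁺ (x ∷ [])      (e , _)   ch = e , ch
  Chain-++⁺ (x ∷ x′ ∷ xs) (e , ch₁) ch = e , Chain-++⁺ (x′ ∷ xs) ch₁ ch

  Chain-segment : ∀ xs {y ys z zs} → Chain G (xs ++ y ∷ ys ++ z ∷ zs) → Chain G (y ∷ ys ++ [ z ])
  Chain-segment xs {y} {ys} ch = proj₁ (Chain-++⁻ (y ∷ ys) (proj₂ (Chain-++⁻ xs ch)))

  Chain-replace : ∀ xs {y ys z zs ys′} → Chain G (xs ++ y ∷ ys ++ z ∷ zs) → Chain G (y ∷ ys′ ++ [ z ]) →
                  Chain G (xs ++ y ∷ ys′ ++ z ∷ zs)
  Chain-replace xs {y} {ys} {ys′ = ys′} ch new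
    with before , rest ← Chain-++⁻ xs ch
    with _ , after ← Chain-++⁻ (y ∷ ys) rest =
    Chain-++⁺ xs before (Chain-++⁺ (y ∷ ys′) new after)

  Chain-bracket⁺ : ∀ {u x xs z w} → E G u x → Chain G (x ∷ xs) → last (x ∷ xs) ≡ just z → E G z w →
                   Chain G (u ∷ x ∷ xs ++ [ w ])
  Chain-bracket⁺ {xs = []}     eu _        refl ew = eu , ew , tt
  Chain-bracket⁺ {xs = y ∷ xs} eu (e , ch) eq   ew = eu , Chain-bracket⁺ e ch eq ew

  Chain-bracket⁻ : ∀ {u x xs w} → Chain G (u ∷ x ∷ xs ++ [ w ]) →
                   E G u x × Chain G (x ∷ xs) × ∃[ z ] last (x ∷ xs) ≡ just z × E G z w
  Chain-bracket⁻ {xs = []}     (eu , ew , _) = eu , tt , _ , refl , ew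
  Chain-bracket⁻ {xs = y ∷ xs} (eu , ch) with e , ch′ , z , eq , ew ← Chain-bracket⁻ ch =
    eu , (e , ch′) , z , eq , ew

  interior-Chain : ∀ {u xs w} → Chain G (u ∷ xs ++ [ w ]) → Chain G xs
  interior-Chain {xs = []}    _  = tt
  interior-Chain {xs = _ ∷ _} ch = proj₁ (proj₂ (Chain-bracket⁻ ch))

  module _ {S : Subset n} {m : ℕ} (Cs : Components G S m) where
    open Components Cs

    InC? : ∀ c x → Dec (InC G Cs c x)
    InC? c x = Maybe.≡-dec Fin._≟_ (comp x) (just c)

    InC⇒∉S : ∀ {c x} → InC G Cs c x → x ∉ S
    InC⇒∉S {x = x} x∈c x∈S with () ← trans (sym (comp-S x x∈S)) x∈c

    vertexSet : Fin m → Subset n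
    vertexSet c = Vec.tabulate (inC? G Cs c)

    ∈-vertexSet⁺ : ∀ {c x} → InC G Cs c x → x ∈ vertexSet c
    ∈-vertexSet⁺ {c} {x} x∈c = Vec.lookup⇒[]= x _ (trans (Vec.lookup∘tabulate (inC? G Cs c) x) inC?-true)
      where
      inC?-true : inC? G Cs c x ≡ true
      inC?-true rewrite x∈c = dec-true (c Fin.≟ c) refl

    ∈-vertexSet⁻ : ∀ {c x} → x ∈ vertexSet c → InC G Cs c x
    ∈-vertexSet⁻ {c} {x} x∈ = sound (trans (sym (Vec.lookup∘tabulate (inC? G Cs c) x)) (Vec.[]=⇒lookup x∈))
      where
      sound : inC? G Cs c x ≡ true → InC G Cs c x
      sound with comp x
      ... | nothing = λ ()
      ... | just d with c Fin.≟ d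
      ...   | yes refl = λ _ → refl
      ...   | no _     = λ ()

    componentOf : List (Fin n) → Maybe (Fin m)
    componentOf []      = nothing
    componentOf (x ∷ _) = comp x

    walk-componentOf : ∀ {xs y} → Chain G xs → All (_∉ S) xs → y ∈ₗ xs → comp y ≡ componentOf xs
    walk-componentOf {x ∷ xs}     _        _          (here refl) = refl
    walk-componentOf {x ∷ y ∷ xs} (e , ch) (x∉S ∷ ∉S) (there p)
      with c , x∈c ← comp-notS x x∉S =
      trans (walk-componentOf ch ∉S p)
            (trans (comp-sep x y c x∈c (step x∉S e (here (All.head ∉S)))) (sym x∈c))

    Detour : Fin m → Fin n → Fin n → List (Fin n) → Set
    Detour c u w N = Chain G (u ∷ N ++ [ w ]) × Unique N × All (InC G Cs c) N

-- q-values and detours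

module _ {n : ℕ} (G : Graph n) {S : Subset n} {m : ℕ} (Cs : Components G S m) where
  open Components Cs

  module _ (c : Fin m) where

    SingleCommon? : ∀ u w z → Dec (SingleCommon G Cs u w c z)
    SingleCommon? u w z = InC? G Cs c z ×-dec E? G u z ×-dec E? G w z ×-dec only u ×-dec only w
      where
      only : ∀ x → Dec (∀ z′ → InC G Cs c z′ → E G x z′ → z′ ≡ z)
      only x = Fin.all? λ z′ → InC? G Cs c z′ →-dec E? G x z′ →-dec z′ Fin.≟ z

    ∃-nbr-other-than? : ∀ x a → Dec (∃ λ z → InC G Cs c z × E G x z × z ≢ a)
    ∃-nbr-other-than? x a = Fin.any? λ z → InC? G Cs c z ×-dec E? G x z ×-dec ¬? (z Fin.≟ a)

    distinct-neighbours : ∀ {u w} → HasNbr G Cs u c → HasNbr G Cs w c → ¬ ∃ (SingleCommon G Cs u w c) →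
      ∃[ a ] ∃[ b ] a ≢ b × InC G Cs c a × E G u a × InC G Cs c b × E G w b
    distinct-neighbours {u} {w} (a , a∈c , ua) (b , b∈c , wb) ¬single with a Fin.≟ b
    ... | no a≢b = a , b , a≢b , a∈c , ua , b∈c , wb
    ... | yes refl with ∃-nbr-other-than? u a | ∃-nbr-other-than? w a
    ...   | yes (z , z∈c , uz , z≢a) | _ = z , a , z≢a , z∈c , uz , b∈c , wb
    ...   | no _ | yes (z , z∈c , wz , z≢a) = a , z , z≢a ∘ sym , a∈c , ua , z∈c , wz
    ...   | no none-u | no none-w = contradiction (a , a∈c , ua , wb , only none-u , only none-w) ¬single
      where
      only : ∀ {x} → ¬ ∃ (λ z → InC G Cs c z × E G x z × z ≢ a) → ∀ z → InC G Cs c z → E G x z → z ≡ a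
      only none z z∈c xz with z Fin.≟ a
      ... | yes z≡a = z≡a
      ... | no  z≢a = contradiction (z , z∈c , xz , z≢a) none

    clique-Chain : IsClique G Cs c → ∀ {xs} → All (InC G Cs c) xs → Unique xs → Chain G xs
    clique-Chain isC {[]}         _                _                 = tt
    clique-Chain isC {x ∷ []}     _                _                 = tt
    clique-Chain isC {x ∷ y ∷ xs} (x∈c ∷ y∈c ∷ ∈c) ((x≢y ∷ _) ∷ xs!) =
      isC x y x∈c y∈c x≢y , clique-Chain isC (y∈c ∷ ∈c) xs!

    clique-detour : IsClique G Cs c → ∀ {u w a b} → a ≢ b → InC G Cs c a → E G u a → InC G Cs c b → E G w b →
      ∃[ N ] Detour G Cs c u w N × csize G Cs c ≤ length N
    clique-detour isC {u} {w} {a} {b} a≢b a∈c ua b∈c wb =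
      N , (Chain-bracket⁺ G ua (clique-Chain isC ∈c N!) (last-∷ʳ (a ∷ mid)) (E-sym G wb) , N! , ∈c) ,
      ∣p∣≤length (vertexSet G Cs c) covers
      where
      Inner : Fin n → Set
      Inner y = InC G Cs c y × y ≢ a × y ≢ b
      inner? : Decidable Inner
      inner? y = InC? G Cs c y ×-dec ¬? (y Fin.≟ a) ×-dec ¬? (y Fin.≟ b)
      mid : List (Fin n)
      mid = filter inner? (allFin n)
      N : List (Fin n)
      N = a ∷ mid ++ [ b ]
      inner : ∀ {y} → y ∈ₗ mid → Inner y
      inner p = proj₂ (∈-filter⁻ inner? {xs = allFin n} p)
      ∈c : All (InC G Cs c) N
      ∈c = a∈c ∷ All.++⁺ (All.tabulate (proj₁ ∘ inner)) (b∈c ∷ [])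
      a∉ : a ∉ₗ mid ++ [ b ]
      a∉ p with ∈-++⁻ mid p
      ... | inj₁ q          = proj₁ (proj₂ (inner q)) refl
      ... | inj₂ (here a≡b) = a≢b a≡b
      N! : Unique N
      N! = All.¬Any⇒All¬ _ a∉ ∷ Unique.++⁺ (Unique.filter⁺ inner? (Unique.allFin⁺ n)) ([] ∷ [])
             λ { (p , here refl) → proj₂ (proj₂ (inner p)) refl }
      covers : ∀ {y} → y ∈ vertexSet G Cs c → y ∈ₗ N
      covers {y} y∈c with y Fin.≟ a | y Fin.≟ b
      ... | yes refl | _        = here refl
      ... | no _     | yes refl = there (∈-++⁺ʳ mid (here refl))
      ... | no y≢a   | no y≢b   =
        there (∈-++⁺ˡ (∈-filter⁺ inner? (∈-allFin y) (∈-vertexSet⁻ G Cs y∈c , y≢a , y≢b)))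

    TreeDist? : ∀ a b d → Dec (TreeDist G Cs c a b d)
    TreeDist? a b d with ∃-list-of-length? (suc d) (λ ps → IsPath? G a b ps ×-dec all? (InC? G Cs c) ps)
    ... | yes (ps , len , path , ∈c) = yes (ps , path , ∈c , cong (_∸ 1) len)
    ... | no none = no λ { ([] , (() , _) , _)
                         ; (x ∷ ps , path , ∈c , refl) → none (x ∷ ps , refl , path , ∈c) }

    NbrDist : Fin n → Fin n → ℕ → Set
    NbrDist u w d =
      ∃[ wu ] ∃[ wv ] InC G Cs c wu × E G u wu × InC G Cs c wv × E G w wv × TreeDist G Cs c wu wv d

    NbrDist? : ∀ u w d → Dec (NbrDist u w d)
    NbrDist? u w d = Fin.any? λ wu → Fin.any? λ wv →
      InC? G Cs c wu ×-dec E? G u wu ×-dec InC? G Cs c wv ×-dec E? G w wv ×-dec TreeDist? wu wv d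

    NbrDist≤n : ∀ {u w d} → NbrDist u w d → d ≤ n
    NbrDist≤n (_ , _ , _ , _ , _ , _ , x ∷ ps , (_ , _ , _ , path!) , _ , refl) =
      ≤-trans (n≤1+n _) (subst (length (x ∷ ps) ≤_) (length-tabulate {n = n} id)
                                (Unique-⊆⇒length≤ path! λ {y} _ → ∈-allFin y))

  module _ {cls : Fin m → Bool} where

    q⇒detour : ValidClassification G Cs cls → ∀ {c u w r} → Q G Cs cls c u w r →
               ∃[ N ] Detour G Cs c u w N × r ≤ suc (length N)
    q⇒detour _ (q-single z _ (z∈c , uz , wz , _)) =
      [ z ] , ((uz , E-sym G wz , tt) , ([] ∷ []) , (z∈c ∷ [])) , ≤-refl
    q⇒detour vc {c} (q-clique isC hu hw ¬single)
      with a , b , a≢b , a∈c , ua , b∈c , wb ← distinct-neighbours c hu hw ¬single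
      with N , detour , c≤N ← clique-detour c (proj₁ (vc c) isC) a≢b a∈c ua b∈c wb =
      N , detour , s≤s c≤N
    q⇒detour _ (q-tree _ _ _ _ ((_ , _ , _ , uwu , _ , wwv , x ∷ ps , (refl , last≡ , ch , ps!) , ∈c , refl)
                               , _)) =
      x ∷ ps , (Chain-bracket⁺ G uwu ch last≡ (E-sym G wwv) , ps! , ∈c) , ≤-refl

    detour⇒NbrDist : ∀ {c u w x xs} → Detour G Cs c u w (x ∷ xs) → NbrDist c u w (length xs)
    detour⇒NbrDist {x = x} {xs} (ch , xs! , ∈c) with ux , chx , z , last≡ , zw ← Chain-bracket⁻ G ch =
      x , z , All.head ∈c , ux , All.lookup ∈c (last-∈ last≡) , E-sym G zw ,
      x ∷ xs , (refl , last≡ , chx , xs!) , ∈c , refl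

    NbrDist⇒q : ∀ {c u w d} → cls c ≡ false → NbrDist c u w d → ∃[ r ] Q G Cs cls c u w r × 2 + d ≤ r
    NbrDist⇒q {c} {u} {w} class dist
      with r , at-r@(wu , wv , wu∈c , uwu , wv∈c , wwv , _) , max
             ← bounded-maximum (NbrDist? c u w) n (NbrDist≤n c) dist =
      2 + r , q-tree r class (wu , wu∈c , uwu) (wv , wv∈c , wwv)
                     (at-r , λ wu wv d wu∈c uwu wv∈c wwv t → max (wu , wv , wu∈c , uwu , wv∈c , wwv , t)) ,
      s≤s (s≤s (max dist))

    clique-detour⇒q : ∀ {c u w x xs} → cls c ≡ true → Detour G Cs c u w (x ∷ xs) →
                      ∃[ r ] Q G Cs cls c u w r × length (x ∷ xs) < r
    clique-detour⇒q {c} {u} {w} {x} class (ch , xs! , ∈c)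
      with ux , _ , z , last≡ , zw ← Chain-bracket⁻ G ch
      with Fin.any? (SingleCommon? c u w)
    ... | yes (s , single@(_ , _ , _ , only-u , only-w)) =
      2 , q-single s class single , s≤s (head≡last⇒length≤1 xs! refl (trans last≡ (cong just z≡x)))
      where
      z≡x : z ≡ x
      z≡x = trans (only-w z (All.lookup ∈c (last-∈ last≡)) (E-sym G zw)) (sym (only-u x (All.head ∈c) ux))
    ... | no ¬single =
      suc (csize G Cs c) ,
      q-clique class (x , All.head ∈c , ux) (z , All.lookup ∈c (last-∈ last≡) , E-sym G zw) ¬single ,
      s≤s (length≤∣p∣ (vertexSet G Cs c) xs! (∈-vertexSet⁺ G Cs ∘ All.lookup ∈c))

    detour⇒q : ∀ {c u w x xs} → Detour G Cs c u w (x ∷ xs) → ∃[ r ] Q G Cs cls c u w r × length (x ∷ xs) < r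
    detour⇒q {c} detour with cls c in class
    ... | true  = clique-detour⇒q class detour
    ... | false = NbrDist⇒q class (detour⇒NbrDist detour)

-- Cycles given by their fragments

module _ {l : ℕ} where

  next-last : ∀ {i : Fin (suc l)} → toℕ i ≡ l → next i ≡ zero
  next-last {i} i≡l = Fin.toℕ-injective (begin
    toℕ (next i)        ≡⟨ Fin.toℕ-fromℕ< _ ⟩
    suc (toℕ i) % suc l ≡⟨ cong (λ k → suc k % suc l) i≡l ⟩
    suc l % suc l       ≡⟨ ℕ.n%n≡0 (suc l) ⟩
    0                   ∎)
    where open ≡-Reasoning

  next-suc : ∀ {i j : Fin (suc l)} → toℕ j ≡ suc (toℕ i) → next i ≡ j
  next-suc {i} {j} j≡1+i = Fin.toℕ-injective (begin
    toℕ (next i)        ≡⟨ Fin.toℕ-fromℕ< _ ⟩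
    suc (toℕ i) % suc l ≡⟨ cong (_% suc l) (sym j≡1+i) ⟩
    toℕ j % suc l       ≡⟨ ℕ.m<n⇒m%n≡m (Fin.toℕ<n j) ⟩
    toℕ j               ∎)
    where open ≡-Reasoning

module _ {n : ℕ} where

  fragSeq-cong : ∀ {l} (v : Fin (suc l) → Fin n) {W W′} → (∀ j → W j ≡ W′ j) → fragSeq v W ≡ fragSeq v W′
  fragSeq-cong v W≗W′ = cong concat (tabulate-cong λ j → cong (v j ∷_) (W≗W′ j))

  -- The disjunct says that B is empty (i is the last index) or starts with v (i + 1); it is phrased
  -- through toℕ because next is computed modulo suc l.
  fragSeq-split : ∀ {l} (v : Fin (suc l) → Fin n) (W : Fin (suc l) → List (Fin n)) i →
    ∃[ A ] ∃[ B ] (∀ W′ → (∀ j → j ≢ i → W′ j ≡ W j) → fragSeq v W′ ≡ A ++ v i ∷ W′ i ++ B)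
      × ((B ≡ [] × toℕ i ≡ l) ⊎ ∃[ j ] toℕ j ≡ suc (toℕ i) × ∃[ B′ ] B ≡ v j ∷ B′)
  fragSeq-split {zero}  v W zero = [] , [] , (λ _ _ → refl) , inj₁ (refl , refl)
  fragSeq-split {suc l} v W zero =
    [] , fragSeq (v ∘′ suc) (W ∘′ suc) ,
    (λ W′ agree → cong (λ B → v zero ∷ W′ zero ++ B) (fragSeq-cong (v ∘′ suc) λ j → agree (suc j) λ ())) ,
    inj₂ (suc zero , refl , _ , refl)
  fragSeq-split {suc l} v W (suc i)
    with A , B , split , follows ← fragSeq-split (v ∘′ suc) (W ∘′ suc) i =
    v zero ∷ W zero ++ A , B , split′ , follows′ follows
    where
    split′ : ∀ W′ → (∀ j → j ≢ suc i → W′ j ≡ W j) →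
             fragSeq v W′ ≡ (v zero ∷ W zero ++ A) ++ v (suc i) ∷ W′ (suc i) ++ B
    split′ W′ agree = begin
      v zero ∷ W′ zero ++ fragSeq (v ∘′ suc) (W′ ∘′ suc)
        ≡⟨ cong₂ (λ X Y → v zero ∷ X ++ Y) (agree zero λ ())
                 (split (W′ ∘′ suc) λ j j≢i → agree (suc j) (j≢i ∘′ Fin.suc-injective)) ⟩
      v zero ∷ W zero ++ A ++ v (suc i) ∷ W′ (suc i) ++ B
        ≡⟨ ++-assoc (v zero ∷ W zero) A _ ⟨
      (v zero ∷ W zero ++ A) ++ v (suc i) ∷ W′ (suc i) ++ B ∎
      where open ≡-Reasoning
    follows′ : (B ≡ [] × toℕ i ≡ l) ⊎ (∃[ j ] toℕ j ≡ suc (toℕ i) × ∃[ B′ ] B ≡ v (suc j) ∷ B′) →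
               (B ≡ [] × suc (toℕ i) ≡ suc l) ⊎ (∃[ j ] toℕ j ≡ suc (suc (toℕ i)) × ∃[ B′ ] B ≡ v j ∷ B′)
    follows′ (inj₁ (B≡[] , i≡l))          = inj₁ (B≡[] , cong suc i≡l)
    follows′ (inj₂ (j , j≡1+i , B′ , B≡)) = inj₂ (suc j , cong suc j≡1+i , B′ , B≡)

  record Focus {l} (v : Fin (suc l) → Fin n) (W : Fin (suc l) → List (Fin n)) (i : Fin (suc l)) : Set where
    field
      before after rest : List (Fin n)
      split  : ∀ W′ → (∀ j → j ≢ i → W′ j ≡ W j) → fragSeq v W′ ≡ before ++ v i ∷ W′ i ++ after
      closes : after ++ [ v zero ] ≡ v (next i) ∷ rest

    closed-split : ∀ W′ → (∀ j → j ≢ i → W′ j ≡ W j) →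
                   fragSeq v W′ ++ [ v zero ] ≡ before ++ v i ∷ W′ i ++ v (next i) ∷ rest
    closed-split W′ agree = begin
      fragSeq v W′ ++ [ v zero ]                     ≡⟨ cong (_++ [ v zero ]) (split W′ agree) ⟩
      (before ++ v i ∷ W′ i ++ after) ++ [ v zero ]  ≡⟨ ++-assoc before _ _ ⟩
      before ++ v i ∷ (W′ i ++ after) ++ [ v zero ]  ≡⟨ cong (λ t → before ++ v i ∷ t) (++-assoc (W′ i) _ _) ⟩
      before ++ v i ∷ W′ i ++ after ++ [ v zero ]    ≡⟨ cong (λ t → before ++ v i ∷ W′ i ++ t) closes ⟩
      before ++ v i ∷ W′ i ++ v (next i) ∷ rest      ∎
      where open ≡-Reasoning

  focus : ∀ {l} (v : Fin (suc l) → Fin n) W i → Focus v W i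
  focus v W i with A , B , split , follows ← fragSeq-split v W i with follows
  ... | inj₁ (refl , i≡l) =
    record { split = split ; closes = cong (λ j → [ v j ]) (sym (next-last i≡l)) }
  ... | inj₂ (j , j≡1+i , B′ , refl) =
    record { split = split ; closes = cong (λ k → v k ∷ B′ ++ [ v zero ]) (sym (next-suc j≡1+i)) }

  module _ {l} (v : Fin (suc l) → Fin n) (W : Fin (suc l) → List (Fin n)) where

    v∈fragSeq : ∀ j → v j ∈ₗ fragSeq v W
    v∈fragSeq j = ∈-concat⁺′ (here refl) (∈-tabulate⁺ {f = λ i → v i ∷ W i} j)

    ∈-fragSeq⁻ : ∀ {y} → y ∈ₗ fragSeq v W → ∃[ j ] (y ≡ v j ⊎ y ∈ₗ W j)
    ∈-fragSeq⁻ p with xs , p′ , xs∈ ← ∈-concat⁻′ (tabulate (λ i → v i ∷ W i)) p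
                  with j , refl ← ∈-tabulate⁻ {f = λ i → v i ∷ W i} xs∈
                  with p′
    ... | here y≡vj = j , inj₁ y≡vj
    ... | there y∈W = j , inj₂ y∈W

  fragSeq-Unique⇒tabulate-Unique : ∀ {l} (v : Fin (suc l) → Fin n) W →
                                   Unique (fragSeq v W) → Unique (tabulate v)
  fragSeq-Unique⇒tabulate-Unique {zero}  v W _             = [] ∷ []
  fragSeq-Unique⇒tabulate-Unique {suc l} v W (v₀∉ ∷ rest!) =
    All.¬Any⇒All¬ _ v₀∉tail
    ∷ fragSeq-Unique⇒tabulate-Unique (v ∘′ suc) (W ∘′ suc) (proj₁ (proj₂ (Unique-++⁻ (W zero) rest!)))
    where
    v₀∉tail : v zero ∉ₗ tabulate (v ∘′ suc)
    v₀∉tail p with j , v₀≡ ← ∈-tabulate⁻ p =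
      All.lookup v₀∉ (∈-++⁺ʳ (W zero) (v∈fragSeq (v ∘′ suc) (W ∘′ suc) j)) v₀≡

-- Rerouting one fragment at a time

module Rerouting {n} (G : Graph n) {S : Subset n} {m : ℕ} (Cs : Components G S m)
  {cls : Fin m → Bool} (vc : ValidClassification G Cs cls)
  {L : Fin n → Fin n → Subset m} (vl : ValidLabelling G Cs cls ∣ S ∣ L)
  {l : ℕ} (v : Fin (suc l) → Fin n) (v∈S : ∀ i → v i ∈ S) where

  open Components Cs

  Fragments : Set
  Fragments = Fin (suc l) → List (Fin n)

  ValidFragments : Fragments → Set
  ValidFragments W = (∀ j → All (_∉ S) (W j)) × IsCycle G (fragSeq v W)

  Labelled : Fin (suc l) → List (Fin n) → Set
  Labelled i xs = xs ≡ [] ⊎ ∃[ c ] c ∈ L (v i) (v (next i)) × All (InC G Cs c) xs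

  usedComponents : Fragments → List (Fin m)
  usedComponents W = catMaybes (tabulate (componentOf G Cs ∘ W))

  Improvement : Fragments → Fin (suc l) → Set
  Improvement W i = ∃[ W′ ] ValidFragments W′ × Labelled i (W′ i) × (∀ j → j ≢ i → W′ j ≡ W j)
                    × length (fragSeq v W) ≤ length (fragSeq v W′)

  module _ {W : Fragments} (valid : ValidFragments W) where

    -- IsCycle G (fragSeq v W) unfolds to a triple, as fragSeq v W begins with v zero.
    private
      W∉S : ∀ j → All (_∉ S) (W j)
      W∉S = proj₁ valid
      W! : Unique (fragSeq v W)
      W! = proj₁ (proj₂ (proj₂ valid))
      closed-Chain : Chain G (fragSeq v W ++ [ v zero ])
      closed-Chain = proj₂ (proj₂ (proj₂ valid))

    fragment-Chain : ∀ i → Chain G (v i ∷ W i ++ [ v (next i) ])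
    fragment-Chain i = Chain-segment G before (subst (Chain G) (closed-split W λ _ _ → refl) closed-Chain)
      where open Focus (focus v W i)

    fragment-Unique : ∀ i → Unique (W i)
    fragment-Unique i = proj₁ (Unique-++⁻ (W i) (AllPairs.tail from-v-i!))
      where
      open Focus (focus v W i)
      from-v-i! : Unique (v i ∷ W i ++ after)
      from-v-i! = proj₁ (proj₂ (Unique-++⁻ before (subst Unique (split W λ _ _ → refl) W!)))

    fragment-in-component : ∀ {i c} → componentOf G Cs (W i) ≡ just c → All (InC G Cs c) (W i)
    fragment-in-component {i} W-i∈c =
      All.tabulate λ p → trans (walk-componentOf G Cs (interior-Chain G (fragment-Chain i)) (W∉S i) p) W-i∈c

    fragment-Detour : ∀ {i c} → componentOf G Cs (W i) ≡ just c → Detour G Cs c (v i) (v (next i)) (W i)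
    fragment-Detour {i} W-i∈c = fragment-Chain i , fragment-Unique i , fragment-in-component W-i∈c

    fragment-used : ∀ {i c} → componentOf G Cs (W i) ≡ just c → c ∈ₗ usedComponents W
    fragment-used {i} W-i∈c =
      ∈-catMaybes⁺ (subst (_∈ₗ tabulate (componentOf G Cs ∘ W)) W-i∈c (∈-tabulate⁺ {f = componentOf G Cs ∘ W} i))

    InC-used : ∀ {c y} → InC G Cs c y → y ∈ₗ fragSeq v W → c ∈ₗ usedComponents W
    InC-used y∈c p with ∈-fragSeq⁻ v W p
    ... | j , inj₁ refl = contradiction (v∈S j) (InC⇒∉S G Cs y∈c)
    ... | j , inj₂ y∈W  =
      fragment-used (trans (sym (walk-componentOf G Cs (interior-Chain G (fragment-Chain j)) (W∉S j) y∈W))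
                           y∈c)

    length-used≤∣S∣ : length (usedComponents W) ≤ ∣ S ∣
    length-used≤∣S∣ = begin
      length (usedComponents W)                ≤⟨ length-catMaybes (tabulate (componentOf G Cs ∘ W)) ⟩
      length (tabulate (componentOf G Cs ∘ W)) ≡⟨ length-tabulate (componentOf G Cs ∘ W) ⟩
      suc l                                    ≡⟨ length-tabulate v ⟨
      length (tabulate v)                      ≤⟨ length≤∣p∣ S (fragSeq-Unique⇒tabulate-Unique v W W!) v∈S′ ⟩
      ∣ S ∣                                    ∎
      where
      open ≤-Reasoning
      v∈S′ : ∀ {x} → x ∈ₗ tabulate v → x ∈ S
      v∈S′ p with j , refl ← ∈-tabulate⁻ {f = v} p = v∈S j

    labelled-exchange : ∀ {i c r} → c ∈ₗ usedComponents W → c ∉ L (v i) (v (next i)) →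
      Q G Cs cls c (v i) (v (next i)) r →
      ∃[ c′ ] c′ ∈ L (v i) (v (next i)) × c′ ∉ₗ usedComponents W
              × ∃[ r′ ] Q G Cs cls c′ (v i) (v (next i)) r′ × r ≤ r′
    labelled-exchange {i} {c} {r} c-used c∉L q with vl (v i) (v (next i)) (v∈S i) (v∈S (next i))
    ... | _ , _ , inj₂ all-labelled , _ = contradiction (all-labelled c r q) c∉L
    ... | labelled-q , _ , inj₁ full , maximal
      with c′ , c′∈L , c′-unused
             ← ∃-missing-member (L (v i) (v (next i)))
                 (subst (length (usedComponents W) ≤_) (sym full) length-used≤∣S∣) c-used c∉L
      with r′ , q′ ← labelled-q c′ c′∈L =
      c′ , c′∈L , c′-unused , r′ , q′ , maximal c′ c r′ r c′∈L c∉L q′ q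

    reroute : ∀ {i c N} → Detour G Cs c (v i) (v (next i)) N → (∀ {y} → y ∈ₗ N → y ∉ₗ fragSeq v W) →
      length (W i) ≤ length N →
      ValidFragments (updateAt W i (const N))
      × length (fragSeq v W) ≤ length (fragSeq v (updateAt W i (const N)))
    reroute {i} {c} {N} (N-Chain , N! , N∈c) fresh W≤N =
      (W′∉S , ≤-trans three longer , W′! , W′-Chain) , longer
      where
      open Focus (focus v W i)
      three : 3 ≤ length (fragSeq v W)
      three = proj₁ (proj₂ valid)
      W′ : Fragments
      W′ = updateAt W i (const N)
      agree : ∀ j → j ≢ i → W′ j ≡ W j
      agree j j≢i = updateAt-minimal j i W j≢i
      W′-i : W′ i ≡ N
      W′-i = updateAt-updates i W
      split₀ : fragSeq v W ≡ before ++ v i ∷ W i ++ after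
      split₀ = split W λ _ _ → refl
      split′ : fragSeq v W′ ≡ before ++ v i ∷ N ++ after
      split′ = trans (split W′ agree) (cong (λ X → before ++ v i ∷ X ++ after) W′-i)
      regroup : ∀ X → before ++ v i ∷ X ++ after ≡ (before ++ [ v i ]) ++ X ++ after
      regroup X = sym (++-assoc before [ v i ] (X ++ after))
      longer : length (fragSeq v W) ≤ length (fragSeq v W′)
      longer = subst₂ _≤_ (cong length (sym split₀)) (cong length (sym split′))
                          (length-replace-≤ before after (s≤s W≤N))
      W′! : Unique (fragSeq v W′)
      W′! = subst Unique (sym (trans split′ (regroup N)))
        (Unique-replace (before ++ [ v i ]) (W i) (subst Unique (trans split₀ (regroup (W i))) W!) N!
          λ p → fresh p ∘ subst (_ ∈ₗ_) (sym (trans split₀ (regroup (W i)))))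
      W′-Chain : Chain G (fragSeq v W′ ++ [ v zero ])
      W′-Chain = subst (Chain G) (sym closed′)
        (Chain-replace G before (subst (Chain G) (closed-split W λ _ _ → refl) closed-Chain) N-Chain)
        where
        closed′ : fragSeq v W′ ++ [ v zero ] ≡ before ++ v i ∷ N ++ v (next i) ∷ rest
        closed′ = trans (closed-split W′ agree) (cong (λ X → before ++ v i ∷ X ++ v (next i) ∷ rest) W′-i)
      W′∉S : ∀ j → All (_∉ S) (W′ j)
      W′∉S j with j Fin.≟ i
      ... | yes refl = subst (All (_∉ S)) (sym W′-i) (All.map (InC⇒∉S G Cs) N∈c)
      ... | no j≢i   = subst (All (_∉ S)) (sym (agree j j≢i)) (W∉S j)

    unchanged : ∀ {i} → Labelled i (W i) → Improvement W i
    unchanged labelled = W , valid , labelled , (λ _ _ → refl) , ≤-refl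

    improve-unlabelled : ∀ {i c x xs} → W i ≡ x ∷ xs → componentOf G Cs (W i) ≡ just c →
                         c ∉ L (v i) (v (next i)) → Improvement W i
    improve-unlabelled {i} {c} W-i W-i∈c c∉L
      with r , q , W<r ← detour⇒q G Cs (subst (Detour G Cs c (v i) (v (next i))) W-i (fragment-Detour W-i∈c))
      with c′ , c′∈L , c′-unused , r′ , q′ , r≤r′ ← labelled-exchange (fragment-used W-i∈c) c∉L q
      with N , N-detour@(_ , _ , N∈c′) , r′≤N ← q⇒detour G Cs vc q′
      with valid′ , longer
             ← reroute N-detour (λ y∈N → c′-unused ∘ InC-used (All.lookup N∈c′ y∈N))
                 (subst (_≤ length N) (cong length (sym W-i)) (≤-pred (≤-trans W<r (≤-trans r≤r′ r′≤N)))) =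
      updateAt W i (const N) , valid′ ,
      inj₂ (c′ , c′∈L , subst (All (InC G Cs c′)) (sym (updateAt-updates i W)) N∈c′) ,
      (λ j j≢i → updateAt-minimal j i W j≢i) , longer

    improve : ∀ i → Improvement W i
    improve i with W i in W-i
    ... | []     = unchanged (inj₁ W-i)
    ... | x ∷ xs
      with c , x∈c ← comp-notS x (All.head (subst (All (_∉ S)) W-i (W∉S i)))
      with W-i∈c ← trans (cong (componentOf G Cs) W-i) x∈c
      with c ∈? L (v i) (v (next i))
    ...   | yes c∈L = unchanged (inj₂ (c , c∈L , fragment-in-component W-i∈c))
    ...   | no  c∉L = improve-unlabelled W-i W-i∈c c∉L

  improve-all : ∀ {W} → ValidFragments W → (is : List (Fin (suc l))) →
    ∃[ W′ ] ValidFragments W′ × (∀ {j} → j ∈ₗ is → Labelled j (W′ j))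
            × length (fragSeq v W) ≤ length (fragSeq v W′)
  improve-all valid []       = _ , valid , (λ ()) , ≤-refl
  improve-all valid (i ∷ is)
    with W₁ , valid₁ , labelled₁ , longer₁ ← improve-all valid is
    with W₂ , valid₂ , labelled-i , agree , longer₂ ← improve valid₁ i =
    W₂ , valid₂ , Labelled-update labelled-i agree labelled₁ , ≤-trans longer₁ longer₂
    where
    Labelled-update : ∀ {W W′ : Fragments} {i is} → Labelled i (W′ i) → (∀ j → j ≢ i → W′ j ≡ W j) →
      (∀ {j} → j ∈ₗ is → Labelled j (W j)) → ∀ {j} → j ∈ₗ i ∷ is → Labelled j (W′ j)
    Labelled-update labelled-i agree labelled (here refl) = labelled-i
    Labelled-update {i = i} labelled-i agree labelled {j} (there p) with j Fin.≟ i
    ... | yes refl = labelled-i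
    ... | no j≢i   = subst (Labelled j) (sym (agree j j≢i)) (labelled p)

lemma29 : ∀ {n} (G : Graph n) (S : Subset n) (m : ℕ) (Cs : Components G S m)
    (cls : Fin m → Bool) → ValidClassification G Cs cls →
    (L : Fin n → Fin n → Subset m) → ValidLabelling G Cs cls ∣ S ∣ L →
    ∀ l (v : Fin (suc l) → Fin n) (W : Fin (suc l) → List (Fin n)) →
    (∀ i → v i ∈ S) → (∀ i → All (_∉ S) (W i)) → IsCycle G (fragSeq v W) →
    ∃[ W′ ] (∀ i → All (_∉ S) (W′ i))
      × IsCycle G (fragSeq v W′)
      × (∀ i → W′ i ≡ [] ⊎ (∃[ c ] c ∈ L (v i) (v (next i)) × All (InC G Cs c) (W′ i)))
      × length (fragSeq v W) ≤ length (fragSeq v W′)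
lemma29 G S m Cs cls vc L vl l v W v∈S W∉S cycle
  with W′ , (W′∉S , cycle′) , labelled , longer
         ← Rerouting.improve-all G Cs vc vl v v∈S (W∉S , cycle) (allFin (suc l)) =
  W′ , W′∉S , cycle′ , (λ i → labelled (∈-allFin i)) , longer
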